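{- Let $S$ be an ap-dioid and set $d(x)=a(a(x))$. Then $d(S)=\{d(x)\mid x\in S\}$ contains $0$ and $1_\sigma$, is closed under $+$, $\cdot$ and $a$, and forms a Boolean algebra with join $+$, meet $\cdot$, complement $a$, least element $0$ and greatest element $1_\sigma$; moreover it is the greatest subset of $S$ forming a Boolean algebra under $+$ and $\cdot$ bounded by $0$ and $1_\sigma$.
   Context: A proto-dioid is a structure $(S,+,\cdot,0,1_\sigma)$ such that $+$ is associative, commutative, idempotent with unit $0$ (order $x\le y\iff x+y=y$), and $1_\sigma\cdot x=x$, $x\cdot 1_\sigma=x$, $x\cdot y+x\cdot z\le x\cdot(y+z)$, $(x+y)\cdot z=x\cdot z+y\cdot z$, $0\cdot x=0$ (multiplication need not be associative). An ap-dioid is a proto-dioid with a unary operation $a$ such that $x\cdot(y\cdot z)=(x\cdot y)\cdot z$ whenever one of $x,y,z$ equals $a(w)$ for some $w$, and $a(x)\cdot x=0$, $a(x\cdot y)=a(x\cdot a(a(y)))$, $a(x)+a(a(x))=1_\sigma$, $a(x)\cdot(y+z)=a(x)\cdot y+a(x)\cdot z$. -}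

module Defs where

open import Level using (Level; _⊔_; suc)
open import Data.Product using (Σ; ∃; _,_; proj₁; proj₂)
open import Data.Sum using (_⊎_)
open import Relation.Binary.PropositionalEquality using (_≡_)
open import Relation.Binary.Core using (Rel)
import Algebra.Lattice.Structures as LS

record ProtoDioid (c : Level) : Set (suc c) where
  infixl 6 _+_
  infixl 7 _·_
  field
    Carrier : Set c
    _+_     : Carrier → Carrier → Carrier
    _·_     : Carrier → Carrier → Carrier
    0#      : Carrier
    1σ      : Carrier

  _≤_ : Carrier → Carrier → Set c
  x ≤ y = x + y ≡ y

  field
    +-assoc     : ∀ x y z → (x + y) + z ≡ x + (y + z)
    +-comm      : ∀ x y → x + y ≡ y + x
    +-idem      : ∀ x → x + x ≡ x
    +-identityˡ : ∀ x → 0# + x ≡ x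
    ·-identityˡ : ∀ x → 1σ · x ≡ x
    ·-identityʳ : ∀ x → x · 1σ ≡ x
    ·-subdistribˡ : ∀ x y z → (x · y + x · z) ≤ (x · (y + z))
    ·-distribʳ  : ∀ x y z → (x + y) · z ≡ x · z + y · z
    ·-zeroˡ     : ∀ x → 0# · x ≡ 0#

record ApDioid (c : Level) : Set (suc c) where
  field
    protoDioid : ProtoDioid c
  open ProtoDioid protoDioid public
  field
    a : Carrier → Carrier

  InImageA : Carrier → Set c
  InImageA x = ∃ λ w → x ≡ a w

  field
    ·-assoc-a  : ∀ x y z → InImageA x ⊎ InImageA y ⊎ InImageA z →
                 x · (y · z) ≡ (x · y) · z
    a-annihil  : ∀ x → a x · x ≡ 0#
    a-mult     : ∀ x y → a (x · y) ≡ a (x · a (a y))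
    a-compl    : ∀ x → a x + a (a x) ≡ 1σ
    a-distribˡ : ∀ x y z → a x · (y + z) ≡ a x · y + a x · z

  d : Carrier → Carrier
  d x = a (a x)

  InD : Carrier → Set c
  InD x = ∃ λ y → x ≡ d y

  module Sub {ℓ : Level} (P : Carrier → Set ℓ) where
    Elem : Set (c ⊔ ℓ)
    Elem = Σ Carrier P

    _≈ₚ_ : Rel Elem c
    u ≈ₚ v = proj₁ u ≡ proj₁ v

    lift₂ : (f : Carrier → Carrier → Carrier) →
            (∀ {x y} → P x → P y → P (f x y)) → Elem → Elem → Elem
    lift₂ f cl u v = f (proj₁ u) (proj₁ v) , cl (proj₂ u) (proj₂ v)

    lift₁ : (f : Carrier → Carrier) →
            (∀ {x} → P x → P (f x)) → Elem → Elem
    lift₁ f cl u = f (proj₁ u) , cl (proj₂ u)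

  record IsBooleanSubset {ℓ : Level} (P : Carrier → Set ℓ) : Set (c ⊔ ℓ) where
    field
      0∈ : P 0#
      1∈ : P 1σ
      +-closed : ∀ {x y} → P x → P y → P (x + y)
      ·-closed : ∀ {x y} → P x → P y → P (x · y)
      ¬ₚ : Sub.Elem P → Sub.Elem P
      isBooleanAlgebra :
        LS.IsBooleanAlgebra (Sub._≈ₚ_ P)
          (Sub.lift₂ P _+_ +-closed) (Sub.lift₂ P _·_ ·-closed) ¬ₚ
          (1σ , 1∈) (0# , 0∈)

  record DIsBooleanAlgebra : Set c where
    field
      0∈D : InD 0#
      1∈D : InD 1σ
      +-closedD : ∀ {x y} → InD x → InD y → InD (x + y)
      ·-closedD : ∀ {x y} → InD x → InD y → InD (x · y)
      a-closedD : ∀ {x} → InD x → InD (a x)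
      isBooleanAlgebraD :
        LS.IsBooleanAlgebra (Sub._≈ₚ_ InD)
          (Sub.lift₂ InD _+_ +-closedD) (Sub.lift₂ InD _·_ ·-closedD)
          (Sub.lift₁ InD a a-closedD)
          (1σ , 1∈D) (0# , 0∈D)

-- The elements a(x), the tests, coincide with d(S), because a(a(a x)) = a x.
-- Tests lie below 1σ, are idempotent, and a(x) ≤ a(y) iff a(x)·y = 0; hence a
-- is antitone and tests commute. De Morgan, a x · a y = a(d x + d y), closes
-- the tests under products, and a sum s of tests has a(s) as complement, which
-- forces d s = s; the Boolean algebra laws are then checked on tests.
-- Maximality: if x has a complement y (x + y = 1σ, y·x = 0) then x ≤ 1σ gives
-- x = d x · x ≤ d x, while y·d x = 0 (by a-mult) gives d x = x·d x ≤ x.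
module Submission where

open import Defs
open import Data.Product using (_×_; _,_; proj₁)
open import Data.Sum using (inj₁)
open import Relation.Binary.PropositionalEquality
import Algebra.Lattice.Structures as LS

module ProtoDioidProperties {c} (D : ProtoDioid c) where
  open ProtoDioid D renaming (_≤_ to infix 4 _≤_)
  open ≡-Reasoning

  +-identityʳ : ∀ x → x + 0# ≡ x
  +-identityʳ x = trans (+-comm x 0#) (+-identityˡ x)

  ≤-antisym : ∀ {x y} → x ≤ y → y ≤ x → x ≡ y
  ≤-antisym {x} {y} x≤y y≤x = trans (sym y≤x) (trans (+-comm y x) x≤y)

  ≤-trans : ∀ {x y z} → x ≤ y → y ≤ z → x ≤ z
  ≤-trans {x} {y} {z} x≤y y≤z = begin
    x + z       ≡⟨ cong (x +_) (sym y≤z) ⟩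
    x + (y + z) ≡⟨ sym (+-assoc x y z) ⟩
    (x + y) + z ≡⟨ cong (_+ z) x≤y ⟩
    y + z       ≡⟨ y≤z ⟩
    z           ∎

  x≤x+y : ∀ x y → x ≤ x + y
  x≤x+y x y = trans (sym (+-assoc x x y)) (cong (_+ y) (+-idem x))

  y≤x+y : ∀ x y → y ≤ x + y
  y≤x+y x y = subst (y ≤_) (+-comm y x) (x≤x+y y x)

  +-least : ∀ {x y z} → x ≤ z → y ≤ z → x + y ≤ z
  +-least {x} {y} {z} x≤z y≤z = trans (+-assoc x y z) (trans (cong (x +_) y≤z) x≤z)

  +-monoʳ-≤ : ∀ z {x y} → x ≤ y → z + x ≤ z + y
  +-monoʳ-≤ z {x} {y} x≤y = +-least (x≤x+y z y) (≤-trans x≤y (y≤x+y z y))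

  +-monoˡ-≤ : ∀ z {x y} → x ≤ y → x + z ≤ y + z
  +-monoˡ-≤ z {x} {y} x≤y = +-least (≤-trans x≤y (x≤x+y y z)) (y≤x+y y z)

  x≤0⇒x≡0 : ∀ {x} → x ≤ 0# → x ≡ 0#
  x≤0⇒x≡0 {x} x≤0 = trans (sym (+-identityʳ x)) x≤0

  ·-monoˡ-≤ : ∀ z {x y} → x ≤ y → x · z ≤ y · z
  ·-monoˡ-≤ z {x} {y} x≤y = trans (sym (·-distribʳ x y z)) (cong (_· z) x≤y)

  ·-monoʳ-≤ : ∀ x {y z} → y ≤ z → x · y ≤ x · z
  ·-monoʳ-≤ x {y} {z} y≤z =
    ≤-trans (x≤x+y (x · y) (x · z))
      (subst (λ w → x · y + x · z ≤ x · w) y≤z (·-subdistribˡ x y z))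

module ApDioidProperties {c} (S : ApDioid c) where
  open ApDioid S renaming (_≤_ to infix 4 _≤_)
  open ProtoDioidProperties protoDioid
  open ≡-Reasoning

  ·-assoc-testˡ : ∀ u y z → a u · (y · z) ≡ (a u · y) · z
  ·-assoc-testˡ u y z = ·-assoc-a (a u) y z (inj₁ (u , refl))

  a1σ≡0# : a 1σ ≡ 0#
  a1σ≡0# = trans (sym (·-identityʳ (a 1σ))) (a-annihil 1σ)

  dx·x≡x : ∀ x → d x · x ≡ x
  dx·x≡x x = begin
    d x · x           ≡⟨ sym (+-identityˡ _) ⟩
    0# + d x · x      ≡⟨ cong (_+ d x · x) (sym (a-annihil x)) ⟩
    a x · x + d x · x ≡⟨ sym (·-distribʳ (a x) (d x) x) ⟩
    (a x + d x) · x   ≡⟨ cong (_· x) (a-compl x) ⟩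
    1σ · x            ≡⟨ ·-identityˡ x ⟩
    x                 ∎

  a0#≡1σ : a 0# ≡ 1σ
  a0#≡1σ = begin
    a 0#      ≡⟨ cong a (sym a1σ≡0#) ⟩
    d 1σ      ≡⟨ sym (·-identityʳ (d 1σ)) ⟩
    d 1σ · 1σ ≡⟨ dx·x≡x 1σ ⟩
    1σ        ∎

  ax≡1σ⇒x≡0# : ∀ {x} → a x ≡ 1σ → x ≡ 0#
  ax≡1σ⇒x≡0# {x} ax≡1σ = begin
    x           ≡⟨ sym (dx·x≡x x) ⟩
    a (a x) · x ≡⟨ cong (λ w → a w · x) ax≡1σ ⟩
    a 1σ · x    ≡⟨ cong (_· x) a1σ≡0# ⟩
    0# · x      ≡⟨ ·-zeroˡ x ⟩
    0#          ∎

  ax≤1σ : ∀ x → a x ≤ 1σ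
  ax≤1σ x = begin
    a x + 1σ          ≡⟨ cong (a x +_) (sym (a-compl x)) ⟩
    a x + (a x + d x) ≡⟨ sym (+-assoc _ _ _) ⟩
    (a x + a x) + d x ≡⟨ cong (_+ d x) (+-idem (a x)) ⟩
    a x + d x         ≡⟨ a-compl x ⟩
    1σ                ∎

  a∘d≡a : ∀ x → a (d x) ≡ a x
  a∘d≡a x = begin
    a (d x)      ≡⟨ cong a (sym (·-identityˡ (d x))) ⟩
    a (1σ · d x) ≡⟨ sym (a-mult 1σ x) ⟩
    a (1σ · x)   ≡⟨ cong a (·-identityˡ x) ⟩
    a x          ∎

  x·y≡0⇒x·dy≡0 : ∀ x y → x · y ≡ 0# → x · d y ≡ 0#
  x·y≡0⇒x·dy≡0 x y x·y≡0 =
    ax≡1σ⇒x≡0# (trans (sym (a-mult x y)) (trans (cong a x·y≡0) a0#≡1σ))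

  ax·y≤y : ∀ x y → a x · y ≤ y
  ax·y≤y x y = subst (a x · y ≤_) (·-identityˡ y) (·-monoˡ-≤ y (ax≤1σ x))

  x·ay≤x : ∀ x y → x · a y ≤ x
  x·ay≤x x y = subst (x · a y ≤_) (·-identityʳ x) (·-monoʳ-≤ x (ax≤1σ y))

  ax·ax≡ax : ∀ x → a x · a x ≡ a x
  ax·ax≡ax x = begin
    a x · a x             ≡⟨ sym (+-identityʳ _) ⟩
    a x · a x + 0#        ≡⟨ cong (a x · a x +_) (sym (a-annihil (a x))) ⟩
    a x · a x + d x · a x ≡⟨ sym (·-distribʳ (a x) (d x) (a x)) ⟩
    (a x + d x) · a x     ≡⟨ cong (_· a x) (a-compl x) ⟩
    1σ · a x              ≡⟨ ·-identityˡ (a x) ⟩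
    a x                   ∎

  ax·dx≡0 : ∀ x → a x · d x ≡ 0#
  ax·dx≡0 x = x·y≡0⇒x·dy≡0 (a x) x (a-annihil x)

  ax·y≡0⇒ax≤ay : ∀ x y → a x · y ≡ 0# → a x ≤ a y
  ax·y≡0⇒ax≤ay x y ax·y≡0 = subst (_≤ a y) (sym ax≡ax·ay) (ax·y≤y x (a y))
    where
    ax≡ax·ay : a x ≡ a x · a y
    ax≡ax·ay = begin
      a x                   ≡⟨ sym (·-identityʳ (a x)) ⟩
      a x · 1σ              ≡⟨ cong (a x ·_) (sym (a-compl y)) ⟩
      a x · (a y + d y)     ≡⟨ a-distribˡ x (a y) (d y) ⟩
      a x · a y + a x · d y ≡⟨ cong (a x · a y +_) (x·y≡0⇒x·dy≡0 (a x) y ax·y≡0) ⟩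
      a x · a y + 0#        ≡⟨ +-identityʳ _ ⟩
      a x · a y             ∎

  ax≤ay⇒ax·y≡0 : ∀ x y → a x ≤ a y → a x · y ≡ 0#
  ax≤ay⇒ax·y≡0 x y ax≤ay =
    x≤0⇒x≡0 (subst (a x · y ≤_) (a-annihil y) (·-monoˡ-≤ y ax≤ay))

  a-antitone : ∀ {x y} → x ≤ y → a y ≤ a x
  a-antitone {x} {y} x≤y = ax·y≡0⇒ax≤ay y x
    (x≤0⇒x≡0 (subst (a y · x ≤_) (a-annihil y) (·-monoʳ-≤ (a y) x≤y)))

  ax·0≡0 : ∀ x → a x · 0# ≡ 0#
  ax·0≡0 x = ax≤ay⇒ax·y≡0 x 0# (subst (a x ≤_) (sym a0#≡1σ) (ax≤1σ x))

  -- a(a y) kills a x · a y ≤ a y, so a x · a y = a y · (a x · a y) ≤ a y · a x.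
  ax·ay≤ay·ax : ∀ x y → a x · a y ≤ a y · a x
  ax·ay≤ay·ax x y = subst (_≤ q · p) (sym pq≡q·pq) (·-monoʳ-≤ q (x·ay≤x p y))
    where
    p = a x
    q = a y
    a[q]·pq≡0 : a q · (p · q) ≡ 0#
    a[q]·pq≡0 = ax≤ay⇒ax·y≡0 q (p · q) (a-antitone (ax·y≤y x q))
    pq≡q·pq : p · q ≡ q · (p · q)
    pq≡q·pq = begin
      p · q                       ≡⟨ sym (·-identityˡ _) ⟩
      1σ · (p · q)                ≡⟨ cong (_· (p · q)) (sym (a-compl y)) ⟩
      (q + a q) · (p · q)         ≡⟨ ·-distribʳ q (a q) (p · q) ⟩
      q · (p · q) + a q · (p · q) ≡⟨ cong (q · (p · q) +_) a[q]·pq≡0 ⟩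
      q · (p · q) + 0#            ≡⟨ +-identityʳ _ ⟩
      q · (p · q)                 ∎

  ax·ay≡ay·ax : ∀ x y → a x · a y ≡ a y · a x
  ax·ay≡ay·ax x y = ≤-antisym (ax·ay≤ay·ax x y) (ax·ay≤ay·ax y x)

  ax·ay≡a[dx+dy] : ∀ x y → a x · a y ≡ a (d x + d y)
  ax·ay≡a[dx+dy] x y = ≤-antisym pq≤r r≤pq
    where
    p = a x
    q = a y
    w = d x + d y
    r = a w
    r≤p : r ≤ p
    r≤p = subst (r ≤_) (a∘d≡a x) (a-antitone (x≤x+y (d x) (d y)))
    r≤q : r ≤ q
    r≤q = subst (r ≤_) (a∘d≡a y) (a-antitone (y≤x+y (d x) (d y)))
    r≤pq : r ≤ p · q
    r≤pq = subst (_≤ p · q) (ax·ax≡ax w) (≤-trans (·-monoˡ-≤ r r≤p) (·-monoʳ-≤ p r≤q))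
    pq·w≡0 : (p · q) · w ≡ 0#
    pq·w≡0 = begin
      (p · q) · w               ≡⟨ sym (·-assoc-testˡ x q w) ⟩
      p · (q · w)               ≡⟨ cong (p ·_) (a-distribˡ y (d x) (d y)) ⟩
      p · (q · d x + q · d y)   ≡⟨ cong (λ t → p · (q · d x + t)) (ax·dx≡0 y) ⟩
      p · (q · d x + 0#)        ≡⟨ cong (p ·_) (+-identityʳ _) ⟩
      p · (q · d x)             ≡⟨ ·-assoc-testˡ x q (d x) ⟩
      (p · q) · d x             ≡⟨ cong (_· d x) (ax·ay≡ay·ax x y) ⟩
      (q · p) · d x             ≡⟨ sym (·-assoc-testˡ y p (d x)) ⟩
      q · (p · d x)             ≡⟨ cong (q ·_) (ax·dx≡0 x) ⟩
      q · 0#                    ≡⟨ ax·0≡0 y ⟩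
      0#                        ∎
    pq≡p·[q·r] : p · q ≡ p · (q · r)
    pq≡p·[q·r] = begin
      p · q                       ≡⟨ sym (·-identityʳ _) ⟩
      (p · q) · 1σ                ≡⟨ cong ((p · q) ·_) (sym (a-compl w)) ⟩
      (p · q) · (r + a r)         ≡⟨ sym (·-assoc-testˡ x q _) ⟩
      p · (q · (r + a r))         ≡⟨ cong (p ·_) (a-distribˡ y r (a r)) ⟩
      p · (q · r + q · a r)       ≡⟨ a-distribˡ x _ _ ⟩
      p · (q · r) + p · (q · a r) ≡⟨ cong (p · (q · r) +_) p·[q·ar]≡0 ⟩
      p · (q · r) + 0#            ≡⟨ +-identityʳ _ ⟩
      p · (q · r)                 ∎
      where
      p·[q·ar]≡0 : p · (q · a r) ≡ 0#
      p·[q·ar]≡0 = trans (·-assoc-testˡ x q (a r)) (x·y≡0⇒x·dy≡0 (p · q) w pq·w≡0)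
    pq≤r : p · q ≤ r
    pq≤r = subst (_≤ r) (sym pq≡p·[q·r]) (≤-trans (ax·y≤y x (q · r)) (ax·y≤y y r))

  complemented⇒dx≡x : ∀ {x y} → x + y ≡ 1σ → y · x ≡ 0# → d x ≡ x
  complemented⇒dx≡x {x} {y} x+y≡1 y·x≡0 = ≤-antisym dx≤x x≤dx
    where
    x≤1σ : x ≤ 1σ
    x≤1σ = subst (x ≤_) x+y≡1 (x≤x+y x y)
    x≤dx : x ≤ d x
    x≤dx = subst₂ _≤_ (dx·x≡x x) (·-identityʳ (d x)) (·-monoʳ-≤ (d x) x≤1σ)
    dx≡x·dx : d x ≡ x · d x
    dx≡x·dx = begin
      d x               ≡⟨ sym (·-identityˡ _) ⟩
      1σ · d x          ≡⟨ cong (_· d x) (sym x+y≡1) ⟩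
      (x + y) · d x     ≡⟨ ·-distribʳ x y (d x) ⟩
      x · d x + y · d x ≡⟨ cong (x · d x +_) (x·y≡0⇒x·dy≡0 y x y·x≡0) ⟩
      x · d x + 0#      ≡⟨ +-identityʳ _ ⟩
      x · d x           ∎
    dx≤x : d x ≤ x
    dx≤x = subst (_≤ x) (sym dx≡x·dx) (x·ay≤x x (a x))

  -- The complement of s = a x + a y is a s = d x · d y, by De Morgan.
  d[ax+ay]≡ax+ay : ∀ x y → d (a x + a y) ≡ a x + a y
  d[ax+ay]≡ax+ay x y = complemented⇒dx≡x (≤-antisym s+as≤1 1≤s+as) (a-annihil s)
    where
    s = a x + a y
    as≡dx·dy : a s ≡ d x · d y
    as≡dx·dy = sym (trans (ax·ay≡a[dx+dy] (a x) (a y)) (cong a (cong₂ _+_ (a∘d≡a x) (a∘d≡a y))))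
    dx≡dx·ay+dx·dy : d x ≡ d x · a y + d x · d y
    dx≡dx·ay+dx·dy = sym (trans (sym (a-distribˡ (a x) (a y) (d y)))
                        (trans (cong (d x ·_) (a-compl y)) (·-identityʳ (d x))))
    dx≤ay+dx·dy : d x ≤ a y + d x · d y
    dx≤ay+dx·dy = subst (_≤ a y + d x · d y) (sym dx≡dx·ay+dx·dy)
      (+-monoˡ-≤ (d x · d y) (ax·y≤y (a x) (a y)))
    1≤s+as : 1σ ≤ s + a s
    1≤s+as = subst (λ t → 1σ ≤ s + t) (sym as≡dx·dy)
      (subst (_≤ s + d x · d y) (a-compl x)
        (subst (a x + d x ≤_) (sym (+-assoc (a x) (a y) _)) (+-monoʳ-≤ (a x) dx≤ay+dx·dy)))
    s+as≤1 : s + a s ≤ 1σ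
    s+as≤1 = +-least (+-least (ax≤1σ x) (ax≤1σ y)) (ax≤1σ s)

  ax+ax·ay≡ax : ∀ x y → a x + a x · a y ≡ a x
  ax+ax·ay≡ax x y = trans (+-comm _ _) (x·ay≤x (a x) y)

  ax·[ax+y]≡ax+ax·y : ∀ x y → a x · (a x + y) ≡ a x + a x · y
  ax·[ax+y]≡ax+ax·y x y = trans (a-distribˡ x (a x) y) (cong (_+ a x · y) (ax·ax≡ax x))

  ax·[ax+ay]≡ax : ∀ x y → a x · (a x + a y) ≡ a x
  ax·[ax+ay]≡ax x y = trans (ax·[ax+y]≡ax+ax·y x (a y)) (ax+ax·ay≡ax x y)

  +-distribˡ-·-tests : ∀ x y z → a x + a y · a z ≡ (a x + a y) · (a x + a z)
  +-distribˡ-·-tests x y z = sym (begin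
    (p + q) · (p + r)         ≡⟨ ·-distribʳ p q (p + r) ⟩
    p · (p + r) + q · (p + r) ≡⟨ cong₂ _+_ (ax·[ax+ay]≡ax x z) (a-distribˡ y p r) ⟩
    p + (q · p + q · r)       ≡⟨ sym (+-assoc _ _ _) ⟩
    (p + q · p) + q · r       ≡⟨ cong (_+ q · r) (trans (+-comm _ _) (ax·y≤y y p)) ⟩
    p + q · r                 ∎)
    where
    p = a x
    q = a y
    r = a z

  0∈D : InD 0#
  0∈D = 0# , sym (trans (cong a a0#≡1σ) a1σ≡0#)

  1∈D : InD 1σ
  1∈D = 1σ , sym (trans (cong a a1σ≡0#) a0#≡1σ)

  +-closedD : ∀ {x y} → InD x → InD y → InD (x + y)
  +-closedD (x , refl) (y , refl) = d x + d y , sym (d[ax+ay]≡ax+ay (a x) (a y))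

  ·-closedD : ∀ {x y} → InD x → InD y → InD (x · y)
  ·-closedD (x , refl) (y , refl) =
    a (d (a x) + d (a y)) , trans (ax·ay≡a[dx+dy] (a x) (a y)) (sym (a∘d≡a _))

  a-closedD : ∀ {x} → InD x → InD (a x)
  a-closedD (x , refl) = a x , refl

  open Sub InD

  _∨_ _∧_ : Elem → Elem → Elem
  _∨_ = lift₂ _+_ +-closedD
  _∧_ = lift₂ _·_ ·-closedD

  ¬_ : Elem → Elem
  ¬_ = lift₁ a a-closedD

  d-isLattice : LS.IsLattice _≈ₚ_ _∨_ _∧_
  d-isLattice = record
    { isEquivalence = record { refl = refl ; sym = sym ; trans = trans }
    ; ∨-comm        = λ _ _ → +-comm _ _
    ; ∨-assoc       = λ _ _ _ → +-assoc _ _ _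
    ; ∨-cong        = cong₂ _+_
    ; ∧-comm        = λ { (_ , x , refl) (_ , y , refl) → ax·ay≡ay·ax (a x) (a y) }
    ; ∧-assoc       = λ { (_ , x , refl) _ _ → sym (·-assoc-testˡ (a x) _ _) }
    ; ∧-cong        = cong₂ _·_
    ; absorptive    = (λ { (_ , x , refl) (_ , y , refl) → ax+ax·ay≡ax (a x) (a y) })
                    , (λ { (_ , x , refl) (_ , y , refl) → ax·[ax+ay]≡ax (a x) (a y) })
    }

  d-isDistributiveLattice : LS.IsDistributiveLattice _≈ₚ_ _∨_ _∧_
  d-isDistributiveLattice = record
    { isLattice   = d-isLattice
    ; ∨-distrib-∧ = (λ { (_ , x , refl) (_ , y , refl) (_ , z , refl) →
                         +-distribˡ-·-tests (a x) (a y) (a z) })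
                  , (λ { (_ , x , refl) (_ , y , refl) (_ , z , refl) →
                         trans (+-comm _ _) (trans (+-distribˡ-·-tests (a x) (a y) (a z))
                           (cong₂ _·_ (+-comm _ _) (+-comm _ _))) })
    ; ∧-distrib-∨ = (λ { (_ , x , refl) _ _ → a-distribˡ (a x) _ _ })
                  , (λ _ _ _ → ·-distribʳ _ _ _)
    }

  d-isBooleanAlgebra : LS.IsBooleanAlgebra _≈ₚ_ _∨_ _∧_ ¬_ (1σ , 1∈D) (0# , 0∈D)
  d-isBooleanAlgebra = record
    { isDistributiveLattice = d-isDistributiveLattice
    ; ∨-complement = (λ { (_ , x , refl) → trans (+-comm _ _) (a-compl (a x)) })
                   , (λ { (_ , x , refl) → a-compl (a x) })
    ; ∧-complement = (λ { (_ , x , refl) → a-annihil (d x) })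
                   , (λ { (_ , x , refl) → ax·dx≡0 (a x) })
    ; ¬-cong = cong a
    }

  Boolean⇒⊆D : ∀ {ℓ} (P : Carrier → Set ℓ) → IsBooleanSubset P → ∀ x → P x → InD x
  Boolean⇒⊆D P isBoolean x px = x , sym (complemented⇒dx≡x x+¬x≡1 ¬x·x≡0)
    where
    open IsBooleanSubset isBoolean
    open LS.IsBooleanAlgebra isBooleanAlgebra using (∨-complementʳ; ∧-complementˡ)
    x+¬x≡1 : x + proj₁ (¬ₚ (x , px)) ≡ 1σ
    x+¬x≡1 = ∨-complementʳ (x , px)
    ¬x·x≡0 : proj₁ (¬ₚ (x , px)) · x ≡ 0#
    ¬x·x≡0 = ∧-complementˡ (x , px)

proposition11p3 : ∀ {c} (S : ApDioid c) → let open ApDioid S in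
    DIsBooleanAlgebra
    × (∀ (P : Carrier → Set c) → IsBooleanSubset P → ∀ x → P x → InD x)
proposition11p3 S = dIsBooleanAlgebra , Boolean⇒⊆D
  where
  open ApDioidProperties S
  dIsBooleanAlgebra : ApDioid.DIsBooleanAlgebra S
  dIsBooleanAlgebra = record
    { 0∈D = 0∈D ; 1∈D = 1∈D ; +-closedD = +-closedD ; ·-closedD = ·-closedD
    ; a-closedD = a-closedD ; isBooleanAlgebraD = d-isBooleanAlgebra }
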